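{- Let $G$ be a connected graph. Then $\mathcal{TE}_+(G)=\mathcal{TS}_+(G)$ if and only if $G\cong K_n$ for some $n$.
   Context: PSD forcing on a graph $G$: vertices are blue or white; starting from an initial blue set $B$, repeatedly apply: if $C$ is a connected component of the graph obtained from $G$ by deleting the currently blue vertices, and $u$ is a blue vertex with $N_G(u)\cap V(C)=\{w\}$, then $w$ becomes blue. $B$ is a PSD forcing set if eventually all vertices are blue; $\mathrm{Z}_+(G)$ is the minimum size of a PSD forcing set. $\mathcal{TE}_+(G)$ has as vertices the PSD forcing sets of size $\mathrm{Z}_+(G)$, with $S_1S_2$ an edge iff there are $v_1\in S_1\setminus S_2$, $v_2\in S_2\setminus S_1$ with $S_1\setminus\{v_1\}=S_2\setminus\{v_2\}$; $\mathcal{TS}_+(G)$ has the same vertices, with $S_1S_2$ an edge iff additionally $v_1v_2\in E(G)$. -}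

module Defs where

open import Data.Nat using (ℕ; _≤_)
open import Data.Bool using (Bool; true; false; not)
open import Data.Fin using (Fin; _≟_)
open import Data.Fin.Subset using (Subset; _∈_; _∉_; ⊤; ⁅_⁆; _∪_; _-_; ∣_∣)
open import Data.Product using (Σ; ∃; ∃-syntax; _×_; _,_)
open import Relation.Nullary using (¬_; does)
open import Relation.Binary.PropositionalEquality using (_≡_)
open import Relation.Binary.Construct.Closure.ReflexiveTransitive using (Star)
open import Function.Bundles using (_⤖_; Bijection)
open import Function.Base using (_$_)

record Graph (n : ℕ) : Set where
  field
    adj   : Fin n → Fin n → Bool
    adj-sym : ∀ u v → adj u v ≡ adj v u
    loopless : ∀ u → adj u u ≡ false
open Graph public

module _ {n : ℕ} (G : Graph n) where

  data Walk : Fin n → Fin n → Set where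
    nil  : ∀ {x} → Walk x x
    cons : ∀ {x y z} → adj G x y ≡ true → Walk y z → Walk x z

  Connected : Set
  Connected = ∀ u v → Walk u v

  -- walk in G - B (all vertices on it are white, i.e. not in B)
  data WhiteWalk (B : Subset n) : Fin n → Fin n → Set where
    wnil  : ∀ {x} → x ∉ B → WhiteWalk B x x
    wcons : ∀ {x y z} → x ∉ B → adj G x y ≡ true → WhiteWalk B y z → WhiteWalk B x z

  -- blue u forces white w: w is the unique neighbour of u in the component
  -- of G - B containing w.
  Forces : Subset n → Fin n → Fin n → Set
  Forces B u w = u ∈ B × w ∉ B × adj G u w ≡ true ×
                 (∀ x → adj G u x ≡ true → WhiteWalk B w x → x ≡ w)

  data ForceStep (B : Subset n) : Subset n → Set where
    force : ∀ u w → Forces B u w → ForceStep B (B ∪ ⁅ w ⁆)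

  IsPSDForcingSet : Subset n → Set
  IsPSDForcingSet B = Star ForceStep B ⊤

  IsMinPSDForcingSet : Subset n → Set
  IsMinPSDForcingSet B = IsPSDForcingSet B × (∀ B' → IsPSDForcingSet B' → ∣ B ∣ ≤ ∣ B' ∣)

  TEAdj : Subset n → Subset n → Set
  TEAdj S₁ S₂ = ∃[ v₁ ] ∃[ v₂ ] (v₁ ∈ S₁ × v₁ ∉ S₂ × v₂ ∈ S₂ × v₂ ∉ S₁ × S₁ - v₁ ≡ S₂ - v₂)

  TSAdj : Subset n → Subset n → Set
  TSAdj S₁ S₂ = ∃[ v₁ ] ∃[ v₂ ] (v₁ ∈ S₁ × v₁ ∉ S₂ × v₂ ∈ S₂ × v₂ ∉ S₁ × S₁ - v₁ ≡ S₂ - v₂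
                                 × adj G v₁ v₂ ≡ true)

  -- TE₊(G) = TS₊(G): same vertex set, so equality means same edges
  TE≡TS : Set
  TE≡TS = ∀ S₁ S₂ → IsMinPSDForcingSet S₁ → IsMinPSDForcingSet S₂ →
          (TEAdj S₁ S₂ → TSAdj S₁ S₂) × (TSAdj S₁ S₂ → TEAdj S₁ S₂)

K : (m : ℕ) → Graph m
K m = record { adj = λ u v → not (does (u ≟ v)) ; adj-sym = symK ; loopless = loopK }
  where
  open import Relation.Binary.PropositionalEquality using (refl) renaming (sym to ≡-sym)
  symK : ∀ u v → not (does (u ≟ v)) ≡ not (does (v ≟ u))
  symK u v with u ≟ v | v ≟ u
  ... | Relation.Nullary.yes _ | Relation.Nullary.yes _ = refl
  ... | Relation.Nullary.no _ | Relation.Nullary.no _ = refl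
  ... | Relation.Nullary.yes p | Relation.Nullary.no q = Data.Empty.⊥-elim (q (≡-sym p))
    where import Data.Empty
  ... | Relation.Nullary.no p | Relation.Nullary.yes q = Data.Empty.⊥-elim (p (≡-sym q))
    where import Data.Empty
  loopK : ∀ u → not (does (u ≟ u)) ≡ false
  loopK u with u ≟ u
  ... | Relation.Nullary.yes _ = refl
  ... | Relation.Nullary.no ¬p = Data.Empty.⊥-elim (¬p refl)
    where import Data.Empty

_≅_ : ∀ {n m} → Graph n → Graph m → Set
_≅_ {n} {m} G H = Σ (Fin n ⤖ Fin m) λ f →
  ∀ u v → adj G u v ≡ adj H (Bijection.to f u) (Bijection.to f v)

-- In a complete graph any two distinct vertices are adjacent, so every TE-edge is a TS-edge.
-- Conversely assume TE = TS. If y forces z from a minimum PSD forcing set S, then z forces y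
-- back from S - y + z, which is therefore again minimum. Were y able to force two vertices
-- w ≠ w′ from S, the two exchanged sets would be TE-adjacent, hence TS-adjacent, so w ~ w′,
-- and y could not force w after all: forces from minimum sets are unique. Now take a minimum
-- set with the largest number of isolated white vertices; all its white vertices are isolated.
-- For a white w with a (blue) neighbour u, minimality then makes the closed neighbourhood of w
-- a clique closed under adjacency, which by connectivity is the whole graph.
module Submission where

open import Defs
open import Data.Nat using (ℕ)
open import Data.Product using (∃-syntax; _×_)

open import Data.Bool using (true; false; not)
open import Data.Bool.Properties using () renaming (_≟_ to _≟ᵇ_)
open import Data.Empty using (⊥; ⊥-elim)
open import Data.Fin using (Fin; _≟_)
open import Data.Fin.Properties using (¬∀⟶∃¬; all?; sequence)
open import Data.Fin.Subset hiding (⊥)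
open import Data.Fin.Subset.Properties
open import Data.Nat using (zero; suc; _≤_; _<_; s≤s; z≤n; _+_; _∸_)
import Data.Nat.Properties as ℕ
open import Data.Product using (_,_; proj₁; proj₂)
open import Data.Sum using (_⊎_; inj₁; inj₂)
open import Data.Vec using (_∷_; []; tabulate; here; there)
open import Data.Vec.Properties using (lookup⇒[]=; []=⇒lookup; lookup∘tabulate)
open import Function.Bundles using (Bijection)
open import Function.Construct.Identity using (⤖-id)
open import Relation.Binary.Construct.Closure.ReflexiveTransitive using (Star; ε; _◅_)
open import Relation.Binary.PropositionalEquality using (_≡_; _≢_; refl; sym; trans; cong; subst)
open import Effect.Monad using (RawMonad)
open import Relation.Nullary using (¬_; Dec; yes; no; does)
open import Relation.Nullary.Negation using (¬¬-Monad)
open import Relation.Nullary.Decidable using (_→-dec_; _×-dec_; ¬?; decidable-stable; ¬¬-excluded-middle)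

∣p∪q∣≤∣p∣+∣q∣ : ∀ {n} (p q : Subset n) → ∣ p ∪ q ∣ ≤ ∣ p ∣ + ∣ q ∣
∣p∪q∣≤∣p∣+∣q∣ []          []          = z≤n
∣p∪q∣≤∣p∣+∣q∣ (true ∷ p)  (true ∷ q)  = s≤s (ℕ.≤-trans (∣p∪q∣≤∣p∣+∣q∣ p q) (ℕ.+-monoʳ-≤ ∣ p ∣ (ℕ.n≤1+n _)))
∣p∪q∣≤∣p∣+∣q∣ (true ∷ p)  (false ∷ q) = s≤s (∣p∪q∣≤∣p∣+∣q∣ p q)
∣p∪q∣≤∣p∣+∣q∣ (false ∷ p) (true ∷ q)  = ℕ.≤-trans (s≤s (∣p∪q∣≤∣p∣+∣q∣ p q)) (ℕ.≤-reflexive (sym (ℕ.+-suc ∣ p ∣ ∣ q ∣)))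
∣p∪q∣≤∣p∣+∣q∣ (false ∷ p) (false ∷ q) = ∣p∪q∣≤∣p∣+∣q∣ p q

x∈p─q⇒x∉q : ∀ {n} {x : Fin n} (p q : Subset n) → x ∈ p ─ q → x ∉ q
x∈p─q⇒x∉q (_ ∷ p) (.true ∷ q) ()        here
x∈p─q⇒x∉q (_ ∷ p) (_ ∷ q)     (there h) (there h') = x∈p─q⇒x∉q p q h h'

x∉p-x : ∀ {n} (p : Subset n) (x : Fin n) → x ∉ p - x
x∉p-x p x h = x∈p─q⇒x∉q p ⁅ x ⁆ h (x∈⁅x⁆ x)

x∈p-y⇒x∈p∧x≢y : ∀ {n} {p : Subset n} {x y : Fin n} → x ∈ p - y → x ∈ p × x ≢ y
x∈p-y⇒x∈p∧x≢y {p = p} {y = y} x∈ = p─q⊆p p ⁅ y ⁆ x∈ , λ { refl → x∉p-x p y x∈ }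

x∉p-y∧x≢y⇒x∉p : ∀ {n} {p : Subset n} {x y : Fin n} → x ∉ p - y → x ≢ y → x ∉ p
x∉p-y∧x≢y⇒x∉p x∉ x≢y x∈ = x∉ (x∈p∧x≢y⇒x∈p-y x∈ x≢y)

x∉p∧x≢y⇒x∉p∪⁅y⁆ : ∀ {n} {p : Subset n} {x y : Fin n} → x ∉ p → x ≢ y → x ∉ p ∪ ⁅ y ⁆
x∉p∧x≢y⇒x∉p∪⁅y⁆ {p = p} {y = y} x∉p x≢y x∈ with x∈p∪q⁻ p ⁅ y ⁆ x∈
... | inj₁ x∈p   = x∉p x∈p
... | inj₂ x∈⁅y⁆ = x≢y (x∈⁅y⁆⇒x≡y y x∈⁅y⁆)

x∉⊤-y⇒x≡y : ∀ {n} {x y : Fin n} → x ∉ ⊤ - y → x ≡ y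
x∉⊤-y⇒x≡y {x = x} {y} x∉ with x ≟ y
... | yes x≡y = x≡y
... | no  x≢y = ⊥-elim (x∉ (x∈p∧x≢y⇒x∈p-y ∈⊤ x≢y))

p-x⊆q⇒p⊆q∪⁅x⁆ : ∀ {n} {p q : Subset n} {x : Fin n} → p - x ⊆ q → p ⊆ q ∪ ⁅ x ⁆
p-x⊆q⇒p⊆q∪⁅x⁆ {q = q} {x} sub {y} y∈p with y ≟ x
... | yes refl = q⊆p∪q q ⁅ x ⁆ (x∈⁅x⁆ x)
... | no  y≢x  = p⊆p∪q ⁅ x ⁆ (sub (x∈p∧x≢y⇒x∈p-y y∈p y≢x))

∪⁅⁆-least : ∀ {n} {p r : Subset n} {x : Fin n} → p ⊆ r → x ∈ r → p ∪ ⁅ x ⁆ ⊆ r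
∪⁅⁆-least {p = p} {x = x} p⊆r x∈r y∈ with x∈p∪q⁻ p ⁅ x ⁆ y∈
... | inj₁ y∈p = p⊆r y∈p
... | inj₂ y∈⁅x⁆ rewrite x∈⁅y⁆⇒x≡y x y∈⁅x⁆ = x∈r

setOf : ∀ {n} {P : Fin n → Set} → (∀ i → Dec (P i)) → Subset n
setOf P? = tabulate (λ i → does (P? i))

module _ {n} {P : Fin n → Set} (P? : ∀ i → Dec (P i)) where

  ∈setOf⁺ : ∀ {i} → P i → i ∈ setOf P?
  ∈setOf⁺ {i} p with P? i in eq
  ... | yes _ = lookup⇒[]= i (setOf P?) (trans (lookup∘tabulate _ i) (cong does eq))
  ... | no ¬p = ⊥-elim (¬p p)

  ∈setOf⁻ : ∀ {i} → i ∈ setOf P? → P i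
  ∈setOf⁻ {i} i∈ with P? i in eq
  ... | yes p = p
  ... | no _ with () ← trans (sym (cong does eq)) (trans (sym (lookup∘tabulate _ i)) ([]=⇒lookup i∈))

exchange : ∀ {n} → Subset n → Fin n → Fin n → Subset n
exchange S y z = (S - y) ∪ ⁅ z ⁆

module _ {n} {S : Subset n} {y z : Fin n} where

  ∣exchange∣≤ : y ∈ S → ∣ exchange S y z ∣ ≤ ∣ S ∣
  ∣exchange∣≤ y∈S = begin
    ∣ (S - y) ∪ ⁅ z ⁆ ∣     ≤⟨ ∣p∪q∣≤∣p∣+∣q∣ (S - y) ⁅ z ⁆ ⟩
    ∣ S - y ∣ + ∣ ⁅ z ⁆ ∣   ≡⟨ cong (∣ S - y ∣ +_) (∣⁅x⁆∣≡1 z) ⟩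
    ∣ S - y ∣ + 1           ≡⟨ ℕ.+-comm ∣ S - y ∣ 1 ⟩
    suc ∣ S - y ∣           ≤⟨ x∈p⇒∣p-x∣<∣p∣ y∈S ⟩
    ∣ S ∣                   ∎
    where open ℕ.≤-Reasoning

  z∈exchange : z ∈ exchange S y z
  z∈exchange = q⊆p∪q (S - y) ⁅ z ⁆ (x∈⁅x⁆ z)

  ∈exchange⁺ : ∀ {x} → x ∈ S → x ≢ y → x ∈ exchange S y z
  ∈exchange⁺ x∈S x≢y = p⊆p∪q ⁅ z ⁆ (x∈p∧x≢y⇒x∈p-y x∈S x≢y)

  ∈exchange⁻ : ∀ {x} → x ∈ exchange S y z → (x ∈ S × x ≢ y) ⊎ x ≡ z
  ∈exchange⁻ {x} x∈ with x∈p∪q⁻ (S - y) ⁅ z ⁆ x∈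
  ... | inj₁ x∈S-y = inj₁ (x∈p-y⇒x∈p∧x≢y x∈S-y)
  ... | inj₂ x∈⁅z⁆ = inj₂ (x∈⁅y⁆⇒x≡y z x∈⁅z⁆)

  ∉exchange⁺ : ∀ {x} → x ∉ S → x ≢ z → x ∉ exchange S y z
  ∉exchange⁺ x∉S = x∉p∧x≢y⇒x∉p∪⁅y⁆ (λ x∈ → x∉S (p─q⊆p S ⁅ y ⁆ x∈))

  ∉exchange⁻ : ∀ {x} → x ∉ exchange S y z → x ≢ y → x ∉ S
  ∉exchange⁻ x∉ x≢y x∈S = x∉ (∈exchange⁺ x∈S x≢y)

  y∉exchange : y ≢ z → y ∉ exchange S y z
  y∉exchange y≢z y∈ with ∈exchange⁻ y∈
  ... | inj₁ (_ , y≢y) = y≢y refl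
  ... | inj₂ y≡z       = y≢z y≡z

  exchange-minus-new : z ∉ S → exchange S y z - z ≡ S - y
  exchange-minus-new z∉S = ⊆-antisym ⊆S-y S-y⊆
    where
    ⊆S-y : exchange S y z - z ⊆ S - y
    ⊆S-y x∈ with x∈p-y⇒x∈p∧x≢y x∈
    ... | x∈′ , x≢z with ∈exchange⁻ x∈′
    ...   | inj₁ (x∈S , x≢y) = x∈p∧x≢y⇒x∈p-y x∈S x≢y
    ...   | inj₂ x≡z         = ⊥-elim (x≢z x≡z)
    S-y⊆ : S - y ⊆ exchange S y z - z
    S-y⊆ x∈ with x∈p-y⇒x∈p∧x≢y x∈
    ... | x∈S , x≢y = x∈p∧x≢y⇒x∈p-y (∈exchange⁺ x∈S x≢y) λ { refl → z∉S x∈S }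

  ⊆exchange∪⁅y⁆ : S ⊆ exchange S y z ∪ ⁅ y ⁆
  ⊆exchange∪⁅y⁆ = p-x⊆q⇒p⊆q∪⁅x⁆ (p⊆p∪q ⁅ z ⁆)

module _ {A : Set} {P : A → Set} where

  ¬¬-minimiser : (f : A → ℕ) {a₀ : A} → P a₀ → ¬ ¬ (∃[ a ] P a × (∀ b → P b → f a ≤ f b))
  ¬¬-minimiser f {a₀} pa₀ ¬min = below (suc (f a₀)) ℕ.≤-refl pa₀
    where
    below : ∀ m {a} → f a < m → P a → ⊥
    below (suc m) {a} (s≤s fa≤m) pa =
      ¬min (a , pa , λ b pb → ℕ.≮⇒≥ λ fb<fa → below m (ℕ.<-≤-trans fb<fa fa≤m) pb)

  ¬¬-maximiser : (f : A → ℕ) (N : ℕ) → (∀ a → P a → f a ≤ N) →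
                 {a₀ : A} → P a₀ → ¬ ¬ (∃[ a ] P a × (∀ b → P b → f b ≤ f a))
  ¬¬-maximiser f N bound pa₀ ¬max = ¬¬-minimiser (λ a → N ∸ f a) pa₀ λ (a , pa , least) →
    ¬max (a , pa , λ b pb → ℕ.≮⇒≥ λ fa<fb →
      ℕ.<⇒≱ (ℕ.∸-monoʳ-< fa<fb (bound b pb)) (least b pb))

¬¬-Π-Fin : ∀ {n} {Q : Fin n → Set} → (∀ i → ¬ ¬ Q i) → ¬ ¬ (∀ i → Q i)
¬¬-Π-Fin = sequence (RawMonad.rawApplicative ¬¬-Monad)

¬¬-Π-Subset : ∀ {n} {Q : Subset n → Set} → (∀ S → ¬ ¬ Q S) → ¬ ¬ (∀ S → Q S)
¬¬-Π-Subset {zero}  q ¬∀ = q [] λ q[] → ¬∀ λ { [] → q[] }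
¬¬-Π-Subset {suc n} q ¬∀ =
  ¬¬-Π-Subset (λ S → q (true ∷ S)) λ qᵢ →
  ¬¬-Π-Subset (λ S → q (false ∷ S)) λ qₒ →
  ¬∀ λ { (true ∷ S) → qᵢ S ; (false ∷ S) → qₒ S }

module _ {n : ℕ} (G : Graph n) where

  private
    _~_ : Fin n → Fin n → Set
    u ~ v = adj G u v ≡ true

    PSD = IsPSDForcingSet G

  ~-sym : ∀ {u v} → u ~ v → v ~ u
  ~-sym {u} {v} u~v = trans (adj-sym G v u) u~v

  ~⇒≢ : ∀ {u v} → u ~ v → u ≢ v
  ~⇒≢ {u} u~u refl with () ← trans (sym u~u) (loopless G u)

  module _ {S : Subset n} where

    whiteWalk-head : ∀ {a b} → WhiteWalk G S a b → a ∉ S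
    whiteWalk-head (wnil a∉)      = a∉
    whiteWalk-head (wcons a∉ _ _) = a∉

    whiteWalk-last : ∀ {a b} → WhiteWalk G S a b → b ∉ S
    whiteWalk-last (wnil b∉)     = b∉
    whiteWalk-last (wcons _ _ w) = whiteWalk-last w

    whiteWalk-snoc : ∀ {a b c} → WhiteWalk G S a b → b ~ c → c ∉ S → WhiteWalk G S a c
    whiteWalk-snoc (wnil a∉)       b~c c∉ = wcons a∉ b~c (wnil c∉)
    whiteWalk-snoc (wcons a∉ a~ w) b~c c∉ = wcons a∉ a~ (whiteWalk-snoc w b~c c∉)

    whiteWalk-++ : ∀ {a b c} → WhiteWalk G S a b → WhiteWalk G S b c → WhiteWalk G S a c
    whiteWalk-++ (wnil _)        w′ = w′
    whiteWalk-++ (wcons a∉ a~ w) w′ = wcons a∉ a~ (whiteWalk-++ w w′)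

    whiteWalk-reverse : ∀ {a b} → WhiteWalk G S a b → WhiteWalk G S b a
    whiteWalk-reverse (wnil a∉)       = wnil a∉
    whiteWalk-reverse (wcons a∉ a~ w) = whiteWalk-snoc (whiteWalk-reverse w) (~-sym a~) a∉

  whiteWalk-antimono : ∀ {S T a b} → S ⊆ T → WhiteWalk G T a b → WhiteWalk G S a b
  whiteWalk-antimono S⊆T (wnil a∉)       = wnil (λ a∈ → a∉ (S⊆T a∈))
  whiteWalk-antimono S⊆T (wcons a∉ a~ w) = wcons (λ a∈ → a∉ (S⊆T a∈)) a~ (whiteWalk-antimono S⊆T w)

  Isolated : Subset n → Fin n → Set
  Isolated S w = w ∉ S × (∀ v → w ~ v → v ∈ S)

  isolated? : ∀ S w → Dec (Isolated S w)
  isolated? S w = ¬? (w ∈? S) ×-dec all? (λ v → (adj G w v ≟ᵇ true) →-dec (v ∈? S))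

  ¬isolated⇒whiteNeighbour : ∀ {S x} → x ∉ S → ¬ Isolated S x → ∃[ t ] x ~ t × t ∉ S
  ¬isolated⇒whiteNeighbour {S} {x} x∉ ¬iso
    with ¬∀⟶∃¬ n _ (λ v → (adj G x v ≟ᵇ true) →-dec (v ∈? S)) (λ nbrs → ¬iso (x∉ , nbrs))
  ... | t , ¬[x~t⇒t∈S] with adj G x t ≟ᵇ true
  ...   | yes x~t = t , x~t , λ t∈ → ¬[x~t⇒t∈S] (λ _ → t∈)
  ...   | no  x≁t = ⊥-elim (¬[x~t⇒t∈S] (λ x~t → ⊥-elim (x≁t x~t)))

  isolated-walk : ∀ {S w v} → Isolated S w → WhiteWalk G S w v → v ≡ w
  isolated-walk _            (wnil _)        = refl
  isolated-walk (_ , nbrs∈S) (wcons _ w~ wk) = ⊥-elim (whiteWalk-head wk (nbrs∈S _ w~))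

  ¬isolated-along : ∀ {S x z} → WhiteWalk G S x z → ¬ Isolated S x → ¬ Isolated S z
  ¬isolated-along x⇝z ¬iso-x iso-z = ¬iso-x (subst (Isolated _) (sym (isolated-walk iso-z (whiteWalk-reverse x⇝z))) iso-z)

  isolated-forced : ∀ {S u w} → Isolated S w → u ∈ S → u ~ w → Forces G S u w
  isolated-forced iso u∈ u~w = u∈ , proj₁ iso , u~w , λ _ _ wk → isolated-walk iso wk

  psd-mono : ∀ {S T} → S ⊆ T → PSD S → PSD T
  psd-mono S⊆T ε = subst PSD (sym (⊆-antisym ⊆⊤ S⊆T)) ε
  psd-mono {S} {T} S⊆T (force u w (u∈ , w∉ , u~w , only) ◅ rest) with w ∈? T
  ... | yes w∈T = psd-mono (∪⁅⁆-least S⊆T w∈T) rest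
  ... | no  w∉T = force u w (S⊆T u∈ , w∉T , u~w , λ x u~x wk → only x u~x (whiteWalk-antimono S⊆T wk))
                ◅ psd-mono (∪⁅⁆-least (λ x∈ → p⊆p∪q ⁅ w ⁆ (S⊆T x∈)) (q⊆p∪q T ⁅ w ⁆ (x∈⁅x⁆ w))) rest

  module Reversal {S : Subset n} {y z : Fin n} (F : Forces G S y z) where

    private
      S′ = exchange S y z
      y∈S = proj₁ F
      z∉S = proj₁ (proj₂ F)
      y~z = proj₁ (proj₂ (proj₂ F))
      only = proj₂ (proj₂ (proj₂ F))

    -- A white walk of S′ cannot leave the S-component of z: its only exit would be y,
    -- whose unique neighbour in that component is z, now blue.
    exchange-component⊆ : ∀ {c v} → WhiteWalk G S z c → WhiteWalk G S′ c v → WhiteWalk G S z v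
    exchange-component⊆ z⇝c (wnil _) = z⇝c
    exchange-component⊆ {c} z⇝c (wcons {y = d} c∉S′ c~d d⇝v) with d ≟ y
    ... | yes refl = ⊥-elim (c∉S′ (subst (_∈ S′) (sym (only c (~-sym c~d) z⇝c)) z∈exchange))
    ... | no  d≢y  = exchange-component⊆ (whiteWalk-snoc z⇝c c~d (∉exchange⁻ (whiteWalk-head d⇝v) d≢y)) d⇝v

    reverse-force : Forces G S′ z y
    reverse-force = z∈exchange , y∉exchange y≢z , ~-sym y~z , only′
      where
      y≢z : y ≢ z
      y≢z refl = z∉S y∈S

      only′ : ∀ x → z ~ x → WhiteWalk G S′ y x → x ≡ y
      only′ x z~x y⇝x with x ≟ y
      ... | yes x≡y = x≡y
      ... | no  x≢y = ⊥-elim (whiteWalk-last z⇝y y∈S)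
        where
        z⇝x = wcons z∉S z~x (wnil (∉exchange⁻ (whiteWalk-last y⇝x) x≢y))
        z⇝y = exchange-component⊆ z⇝x (whiteWalk-reverse y⇝x)

    psd-exchange : PSD S → PSD S′
    psd-exchange p = force z y reverse-force ◅ psd-mono ⊆exchange∪⁅y⁆ p

    min-exchange : IsMinPSDForcingSet G S → IsMinPSDForcingSet G S′
    min-exchange (p , least) = psd-exchange p , λ B pB → ℕ.≤-trans (∣exchange∣≤ y∈S) (least B pB)

  module _ {S : Subset n} {x : Fin n} (x∉S : x ∉ S) (x⇝? : ∀ b → Dec (WhiteWalk G S x b)) where

    private
      AvoidsComponent : Subset n → Set
      AvoidsComponent B = ∀ t → WhiteWalk G S x t → t ∉ B

      recolour : ∀ {B a v} → AvoidsComponent B → WhiteWalk G S x a → WhiteWalk G S a v → WhiteWalk G B a v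
      recolour avoid x⇝a (wnil _)         = wnil (avoid _ x⇝a)
      recolour avoid x⇝a (wcons a∉ a~ w) = wcons (avoid _ x⇝a) a~ (recolour avoid (whiteWalk-snoc x⇝a a~ (whiteWalk-head w)) w)

      firstForce : ∀ {B} → AvoidsComponent B → Star (ForceStep G) B ⊤ →
                   ∃[ y ] ∃[ z ] Forces G S y z × WhiteWalk G S x z
      firstForce avoid ε = ⊥-elim (avoid x (wnil x∉S) ∈⊤)
      firstForce {B} avoid (force y z (y∈B , _ , y~z , only) ◅ rest) with x⇝? z
      ... | no ¬x⇝z = firstForce avoid′ rest
        where
        avoid′ : AvoidsComponent (B ∪ ⁅ z ⁆)
        avoid′ t x⇝t t∈ with x∈p∪q⁻ B ⁅ z ⁆ t∈
        ... | inj₁ t∈B   = avoid t x⇝t t∈B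
        ... | inj₂ t∈⁅z⁆ = ¬x⇝z (subst (WhiteWalk G S x) (x∈⁅y⁆⇒x≡y z t∈⁅z⁆) x⇝t)
      ... | yes x⇝z with y ∈? S
      ...   | no  y∉S = ⊥-elim (avoid y (whiteWalk-snoc x⇝z (~-sym y~z) y∉S) y∈B)
      ...   | yes y∈S = y , z , (y∈S , whiteWalk-last x⇝z , y~z , only′) , x⇝z
        where
        only′ : ∀ v → y ~ v → WhiteWalk G S z v → v ≡ z
        only′ v y~v z⇝v = only v y~v (recolour avoid x⇝z z⇝v)

    -- Along a forcing chain from S, the first force into the component of x is valid from S.
    first-force-into-component : PSD S → ∃[ y ] ∃[ z ] Forces G S y z × WhiteWalk G S x z
    first-force-into-component = firstForce (λ t x⇝t → whiteWalk-last x⇝t)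

  ForcesAreUnique : Set
  ForcesAreUnique = ∀ {S} → IsMinPSDForcingSet G S →
                    ∀ {u w w′} → Forces G S u w → Forces G S u w′ → w ≡ w′

  module _ {S : Subset n} {u w w′ : Fin n} where

    exchanges-TEAdj : w ∉ S → w′ ∉ S → w ≢ w′ → TEAdj G (exchange S u w) (exchange S u w′)
    exchanges-TEAdj w∉S w′∉S w≢w′ =
      w , w′ , z∈exchange , ∉exchange⁺ w∉S w≢w′ , z∈exchange , ∉exchange⁺ w′∉S (λ e → w≢w′ (sym e)) ,
      trans (exchange-minus-new w∉S) (sym (exchange-minus-new w′∉S))

    exchanges-TSAdj⇒~ : TSAdj G (exchange S u w) (exchange S u w′) → w ~ w′
    exchanges-TSAdj⇒~ (v₁ , v₂ , v₁∈ , v₁∉ , v₂∈ , v₂∉ , _ , v₁~v₂)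
      with ∈exchange⁻ v₁∈ | ∈exchange⁻ v₂∈
    ... | inj₁ (v₁∈S , v₁≢u) | _                  = ⊥-elim (v₁∉ (∈exchange⁺ v₁∈S v₁≢u))
    ... | inj₂ _             | inj₁ (v₂∈S , v₂≢u) = ⊥-elim (v₂∉ (∈exchange⁺ v₂∈S v₂≢u))
    ... | inj₂ refl          | inj₂ refl          = v₁~v₂

  TE≡TS⇒forcesAreUnique : TE≡TS G → ForcesAreUnique
  TE≡TS⇒forcesAreUnique te mS {w = w} {w′} u⇒w@(_ , w∉S , _ , only) u⇒w′@(_ , w′∉S , u~w′ , _) with w ≟ w′
  ... | yes w≡w′ = w≡w′
  ... | no  w≢w′ = ⊥-elim (w≢w′ (sym (only w′ u~w′ (wcons w∉S w~w′ (wnil w′∉S)))))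
    where
    w~w′ = exchanges-TSAdj⇒~ (proj₁ (te _ _ (Reversal.min-exchange u⇒w mS) (Reversal.min-exchange u⇒w′ mS))
                                    (exchanges-TEAdj w∉S w′∉S w≢w′))

  min-minus-¬psd : ∀ {S u} → IsMinPSDForcingSet G S → u ∈ S → ¬ PSD (S - u)
  min-minus-¬psd {S} {u} (_ , least) u∈S p = ℕ.<-irrefl refl (ℕ.<-≤-trans (x∈p⇒∣p-x∣<∣p∣ u∈S) (least (S - u) p))

  ⊤-minus-psd : ∀ {a c} → c ~ a → PSD (⊤ - a)
  ⊤-minus-psd {a} {c} c~a = force c a (c∈ , x∉p-x ⊤ a , c~a , only) ◅ psd-mono ⊆⊤⊆ ε
    where
    c∈ = x∈p∧x≢y⇒x∈p-y ∈⊤ (~⇒≢ c~a)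
    ⊆⊤⊆ : ⊤ ⊆ (⊤ - a) ∪ ⁅ a ⁆
    ⊆⊤⊆ = p-x⊆q⇒p⊆q∪⁅x⁆ (λ x∈ → x∈)
    only : ∀ x → c ~ x → WhiteWalk G (⊤ - a) a x → x ≡ a
    only x _ (wnil _)         = refl
    only x _ (wcons _ a~b wk) = ⊥-elim (~⇒≢ a~b (sym (x∉⊤-y⇒x≡y (whiteWalk-head wk))))

  module _ (unique : ForcesAreUnique) {S : Subset n} (mS : IsMinPSDForcingSet G S)
           (allIsolated : ∀ x → x ∉ S → Isolated S x) where

    -- Removing the blue neighbour u of a white vertex w leaves {u, w} as a component of G - (S - u).
    module WhiteNeighbourhood {w u : Fin n} (w∉S : w ∉ S) (w~u : w ~ u) where

      u∈S : u ∈ S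
      u∈S = proj₂ (allIsolated w w∉S) u w~u

      u⇒w : Forces G S u w
      u⇒w = isolated-forced (allIsolated w w∉S) u∈S (~-sym w~u)

      stays : ∀ {c v} → c ≡ u ⊎ c ≡ w → WhiteWalk G (S - u) c v → v ≡ u ⊎ v ≡ w
      stays c∈uw (wnil _) = c∈uw
      stays {c} c∈uw (wcons {y = d} _ c~d d⇝v) with d ≟ u
      ... | yes d≡u = stays (inj₁ d≡u) d⇝v
      ... | no  d≢u = stays (inj₂ (d≡w c∈uw)) d⇝v
        where
        d∉S = x∉p-y∧x≢y⇒x∉p (whiteWalk-head d⇝v) d≢u
        d≡w : c ≡ u ⊎ c ≡ w → d ≡ w
        d≡w (inj₁ refl) = unique mS (isolated-forced (allIsolated d d∉S) u∈S c~d) u⇒w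
        d≡w (inj₂ refl) = ⊥-elim (d∉S (proj₂ (allIsolated w w∉S) d c~d))

      neighbour-closed : ∀ {x} → u ~ x → x ≢ w → w ~ x
      neighbour-closed {x} u~x x≢w with x ∈? S
      ... | no  x∉S = ⊥-elim (x≢w (unique mS (isolated-forced (allIsolated x x∉S) u∈S u~x) u⇒w))
      ... | yes x∈S with adj G w x ≟ᵇ true
      ...   | yes w~x = w~x
      ...   | no  w≁x = ⊥-elim (min-minus-¬psd mS u∈S (force x u x⇒u ◅ psd-mono (p-x⊆q⇒p⊆q∪⁅x⁆ (λ t∈ → t∈)) (proj₁ mS)))
        where
        only : ∀ v → x ~ v → WhiteWalk G (S - u) u v → v ≡ u
        only v x~v u⇝v with stays (inj₁ refl) u⇝v
        ... | inj₁ v≡u  = v≡u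
        ... | inj₂ refl = ⊥-elim (w≁x (~-sym x~v))
        x⇒u : Forces G (S - u) x u
        x⇒u = x∈p∧x≢y⇒x∈p-y x∈S (~⇒≢ (~-sym u~x)) , x∉p-x S u , ~-sym u~x , only

      neighbour-clique : ∀ {v} → w ~ v → u ≢ v → u ~ v
      neighbour-clique {v} w~v u≢v with adj G u v ≟ᵇ true
      ... | yes u~v = u~v
      ... | no  u≁v = ⊥-elim (min-minus-¬psd mS u∈S
                        (force v w v⇒w ◅ force w u w⇒u ◅ psd-mono (p-x⊆q⇒p⊆q∪⁅x⁆ (p⊆p∪q ⁅ w ⁆)) (proj₁ mS)))
        where
        S-u+w = (S - u) ∪ ⁅ w ⁆
        onlyᵥ : ∀ t → v ~ t → WhiteWalk G (S - u) w t → t ≡ w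
        onlyᵥ t v~t w⇝t with stays (inj₂ refl) w⇝t
        ... | inj₁ refl = ⊥-elim (u≁v (~-sym v~t))
        ... | inj₂ t≡w  = t≡w
        v⇒w : Forces G (S - u) v w
        v⇒w = x∈p∧x≢y⇒x∈p-y (proj₂ (allIsolated w w∉S) v w~v) (λ v≡u → u≢v (sym v≡u)) ,
              (λ w∈ → w∉S (proj₁ (x∈p-y⇒x∈p∧x≢y w∈))) , ~-sym w~v , onlyᵥ
        onlyᵤ : ∀ t → w ~ t → WhiteWalk G S-u+w u t → t ≡ u
        onlyᵤ t _ u⇝t with stays (inj₁ refl) (whiteWalk-antimono (p⊆p∪q ⁅ w ⁆) u⇝t)
        ... | inj₁ t≡u  = t≡u
        ... | inj₂ refl = ⊥-elim (whiteWalk-last u⇝t (q⊆p∪q (S - u) ⁅ w ⁆ (x∈⁅x⁆ w)))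
        w⇒u : Forces G S-u+w w u
        w⇒u = q⊆p∪q (S - u) ⁅ w ⁆ (x∈⁅x⁆ w) ,
              x∉p∧x≢y⇒x∉p∪⁅y⁆ (x∉p-x S u) (~⇒≢ (~-sym w~u)) , w~u , onlyᵤ

    ∃white : ∀ {a c} → a ~ c → ∃[ w ] w ∉ S
    ∃white {a} {c} a~c = ¬∀⟶∃¬ n (_∈ S) (_∈? S) λ all∈S →
      ℕ.<-irrefl refl (begin-strict
        ∣ ⊤ {n} ∣   ≤⟨ p⊆q⇒∣p∣≤∣q∣ {p = ⊤} (λ {x} _ → all∈S x) ⟩
        ∣ S ∣       ≤⟨ proj₂ mS (⊤ - a) (⊤-minus-psd (~-sym a~c)) ⟩
        ∣ ⊤ - a ∣   <⟨ x∈p⇒∣p-x∣<∣p∣ {n} {a} {⊤} ∈⊤ ⟩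
        ∣ ⊤ {n} ∣   ∎)
      where open ℕ.≤-Reasoning

    isolated-whites⇒complete : Connected G → ∀ {a b} → a ≢ b → a ~ b
    isolated-whites⇒complete conn {a} {b} a≢b = adjacent (closed-neighbourhood a) (closed-neighbourhood b)
      where
      first-step : Walk G a b → ∃[ c ] a ~ c
      first-step nil                  = ⊥-elim (a≢b refl)
      first-step (cons {y = c} a~c _) = c , a~c
      white = ∃white (proj₂ (first-step (conn a b)))
      w = proj₁ white
      w∉S = proj₂ white
      extend : ∀ {c t} → c ≡ w ⊎ w ~ c → Walk G c t → t ≡ w ⊎ w ~ t
      extend c∈N[w] nil = c∈N[w]
      extend (inj₁ refl) (cons w~d d⇝t) = extend (inj₂ w~d) d⇝t
      extend (inj₂ w~c) (cons {y = d} c~d d⇝t) with d ≟ w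
      ... | yes d≡w = extend (inj₁ d≡w) d⇝t
      ... | no  d≢w = extend (inj₂ (WhiteNeighbourhood.neighbour-closed w∉S w~c c~d d≢w)) d⇝t
      closed-neighbourhood : ∀ t → t ≡ w ⊎ w ~ t
      closed-neighbourhood t = extend (inj₁ refl) (conn w t)
      adjacent : a ≡ w ⊎ w ~ a → b ≡ w ⊎ w ~ b → a ~ b
      adjacent (inj₁ a≡w) (inj₁ b≡w) = ⊥-elim (a≢b (trans a≡w (sym b≡w)))
      adjacent (inj₁ a≡w) (inj₂ w~b) = subst (_~ b) (sym a≡w) w~b
      adjacent (inj₂ w~a) (inj₁ b≡w) = subst (a ~_) (sym b≡w) (~-sym w~a)
      adjacent (inj₂ w~a) (inj₂ w~b) = WhiteNeighbourhood.neighbour-clique w∉S w~a w~b a≢b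

  module _ {S : Subset n} {y z : Fin n} (y⇒z : Forces G S y z) where

    isolated-exchange : ForcesAreUnique → IsMinPSDForcingSet G S → ¬ Isolated S z →
                        ∀ {w} → Isolated S w → Isolated (exchange S y z) w
    isolated-exchange unique mS ¬iso-z {w} iso-w = ∉exchange⁺ (proj₁ iso-w) w≢z , nbrs∈
      where
      w≢z : w ≢ z
      w≢z refl = ¬iso-z iso-w
      nbrs∈ : ∀ v → w ~ v → v ∈ exchange S y z
      nbrs∈ v w~v with v ≟ y
      ... | yes refl = ⊥-elim (w≢z (unique mS (isolated-forced iso-w (proj₁ y⇒z) (~-sym w~v)) y⇒z))
      ... | no  v≢y  = ∈exchange⁺ (proj₂ iso-w v w~v) v≢y

    component-exchange-⊂ : ∀ {x t} → WhiteWalk G S x z → z ~ t → t ∉ S →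
                           (x⇝? : ∀ v → Dec (WhiteWalk G S x v)) →
                           (t⇝? : ∀ v → Dec (WhiteWalk G (exchange S y z) t v)) →
                           setOf t⇝? ⊂ setOf x⇝?
    component-exchange-⊂ {t = t} x⇝z z~t t∉S x⇝? t⇝? =
      (λ v∈ → ∈setOf⁺ x⇝? (whiteWalk-++ x⇝z (z⇝ (∈setOf⁻ t⇝? v∈)))) ,
      z , ∈setOf⁺ x⇝? x⇝z , λ z∈ → whiteWalk-last (∈setOf⁻ t⇝? z∈) z∈exchange
      where
      z⇝ : ∀ {v} → WhiteWalk G (exchange S y z) t v → WhiteWalk G S z v
      z⇝ = Reversal.exchange-component⊆ y⇒z (wcons (whiteWalk-last x⇝z) z~t (wnil t∉S))

  module _ (unique : ForcesAreUnique) (whiteWalk? : ∀ S a b → Dec (WhiteWalk G S a b)) where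

    isolatedCount : Subset n → ℕ
    isolatedCount S = ∣ setOf (isolated? S) ∣

    MaxIsolated : Subset n → Set
    MaxIsolated S = ∀ S′ → IsMinPSDForcingSet G S′ → isolatedCount S′ ≤ isolatedCount S

    private
      componentSize : Subset n × Fin n → ℕ
      componentSize (S , x) = ∣ setOf (whiteWalk? S x) ∣

      Counterexample : Subset n × Fin n → Set
      Counterexample (S , x) = IsMinPSDForcingSet G S × MaxIsolated S × x ∉ S × ¬ Isolated S x

      -- Exchanging along the first force y ⇒ z into the component of x keeps every isolated
      -- vertex isolated, so by maximality the white neighbour t of z is not isolated either,
      -- while its component is a proper part of that of x.
      shrink : ∀ {S x} → Counterexample (S , x) →
               ∃[ S′ ] ∃[ t ] Counterexample (S′ , t) × componentSize (S′ , t) < componentSize (S , x)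
      shrink {S} {x} (mS , maxS , x∉S , ¬iso-x)
        with first-force-into-component x∉S (whiteWalk? S x) (proj₁ mS)
      ... | y , z , y⇒z , x⇝z with ¬isolated⇒whiteNeighbour (whiteWalk-last x⇝z) (¬isolated-along x⇝z ¬iso-x)
      ...   | t , z~t , t∉S = S′ , t , (mS′ , maxS′ , t∉S′ , ¬iso-t) , smaller
        where
        S′ = exchange S y z
        z∉S = whiteWalk-last x⇝z
        I⊆ : setOf (isolated? S) ⊆ setOf (isolated? S′)
        I⊆ w∈ = ∈setOf⁺ (isolated? S′)
                  (isolated-exchange y⇒z unique mS (¬isolated-along x⇝z ¬iso-x) (∈setOf⁻ (isolated? S) w∈))
        mS′ = Reversal.min-exchange y⇒z mS
        maxS′ : MaxIsolated S′
        maxS′ B mB = ℕ.≤-trans (maxS B mB) (p⊆q⇒∣p∣≤∣q∣ I⊆)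
        t∉S′ = ∉exchange⁺ t∉S (λ t≡z → ~⇒≢ z~t (sym t≡z))
        ¬iso-t : ¬ Isolated S′ t
        ¬iso-t iso-t = ℕ.<⇒≱ (p⊂q⇒∣p∣<∣q∣ (I⊆ , t , ∈setOf⁺ (isolated? S′) iso-t , t∉I)) (maxS S′ mS′)
          where
          t∉I : t ∉ setOf (isolated? S)
          t∉I t∈ = z∉S (proj₂ (∈setOf⁻ (isolated? S) t∈) z (~-sym z~t))
        smaller = p⊂q⇒∣p∣<∣q∣ (component-exchange-⊂ y⇒z x⇝z z~t t∉S (whiteWalk? S x) (whiteWalk? S′ t))

      no-counterexample : ∀ {S x} → ¬ Counterexample (S , x)
      no-counterexample c = ¬¬-minimiser componentSize c λ (_ , c₀ , least) →
        let (S′ , t , c′ , smaller) = shrink c₀ in ℕ.<⇒≱ smaller (least (S′ , t) c′)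

    maxIsolated⇒allIsolated : ∀ {S} → IsMinPSDForcingSet G S → MaxIsolated S → ∀ x → x ∉ S → Isolated S x
    maxIsolated⇒allIsolated {S} mS maxS x x∉S =
      decidable-stable (isolated? S x) λ ¬iso → no-counterexample (mS , maxS , x∉S , ¬iso)

  Complete : Set
  Complete = ∀ {u v} → u ≢ v → u ~ v

  ¬¬-whiteWalk? : ¬ ¬ (∀ S a b → Dec (WhiteWalk G S a b))
  ¬¬-whiteWalk? = ¬¬-Π-Subset λ S → ¬¬-Π-Fin λ a → ¬¬-Π-Fin λ b → ¬¬-excluded-middle

  -- The extremal choices and the decidability of white walks are only available under double
  -- negation, which suffices because adjacency is decidable.
  forcesAreUnique⇒complete : Connected G → ForcesAreUnique → Complete
  forcesAreUnique⇒complete conn unique {a} {b} a≢b =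
    decidable-stable (adj G a b ≟ᵇ true) λ a≁b →
    ¬¬-whiteWalk? λ whiteWalk? →
    ¬¬-minimiser ∣_∣ {⊤} ε λ (S , psd , least) →
    ¬¬-maximiser (isolatedCount unique whiteWalk?) n (λ S′ _ → ∣p∣≤n (setOf (isolated? S′)))
                 (psd , least) λ (S₀ , mS₀ , maxS₀) →
    a≁b (isolated-whites⇒complete unique mS₀ (maxIsolated⇒allIsolated unique whiteWalk? mS₀ maxS₀) conn a≢b)

  complete⇒≅K : Complete → G ≅ K n
  complete⇒≅K complete = ⤖-id (Fin n) , same
    where
    same : ∀ u v → adj G u v ≡ not (does (u ≟ v))
    same u v with u ≟ v
    ... | yes refl = loopless G u
    ... | no  u≢v  = complete u≢v

  ≅K⇒complete : ∀ {m} → G ≅ K m → Complete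
  ≅K⇒complete (f , preserves) {u} {v} u≢v with Bijection.to f u ≟ Bijection.to f v in eq
  ... | yes fu≡fv = ⊥-elim (u≢v (Bijection.injective f fu≡fv))
  ... | no  _     = trans (preserves u v) (cong (λ d → not (does d)) eq)

  complete⇒TE≡TS : Complete → TE≡TS G
  complete⇒TE≡TS complete _ _ _ _ = TE⇒TS , TS⇒TE
    where
    TE⇒TS : ∀ {S₁ S₂} → TEAdj G S₁ S₂ → TSAdj G S₁ S₂
    TE⇒TS (v₁ , v₂ , v₁∈ , v₁∉ , v₂∈ , v₂∉ , eq) =
      v₁ , v₂ , v₁∈ , v₁∉ , v₂∈ , v₂∉ , eq , complete λ { refl → v₂∉ v₁∈ }
    TS⇒TE : ∀ {S₁ S₂} → TSAdj G S₁ S₂ → TEAdj G S₁ S₂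
    TS⇒TE (v₁ , v₂ , v₁∈ , v₁∉ , v₂∈ , v₂∉ , eq , _) = v₁ , v₂ , v₁∈ , v₁∉ , v₂∈ , v₂∉ , eq

mainTheorem11 : ∀ {n : ℕ} (G : Graph n) → Connected G →
    (TE≡TS G → ∃[ m ] (G ≅ K m)) × (∃[ m ] (G ≅ K m) → TE≡TS G)
mainTheorem11 {n} G conn = TE≡TS⇒≅K , ≅K⇒TE≡TS
  where
  TE≡TS⇒≅K : TE≡TS G → ∃[ m ] (G ≅ K m)
  TE≡TS⇒≅K te = n , complete⇒≅K G (forcesAreUnique⇒complete G conn (TE≡TS⇒forcesAreUnique G te))
  ≅K⇒TE≡TS : ∃[ m ] (G ≅ K m) → TE≡TS G
  ≅K⇒TE≡TS (_ , G≅K) = complete⇒TE≡TS G (≅K⇒complete G G≅K)
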